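{- For any 3CNF $\varphi$ on $n$ variables (with polynomially many clauses), there are $\mathrm{poly}(n)$-size $\mathsf{AC}^0$-Frege proofs of $\varphi(\vec p)\to\mathrm{Truth}_{bool}([\varphi],\vec p)$.
   Context: Encoding: for a 3CNF $\varphi=\kappa_1\wedge\dots\wedge\kappa_m$ on $n$ variables, a literal $x_i$ or $\neg x_i$ is encoded by the $\lceil\log_2n\rceil$-bit binary encoding $[i]$ of $i-1$ followed by a sign bit (1 for positive, 0 for negative); a clause's encoding concatenates its three literals; $[\varphi]$ concatenates the clause encodings (a fixed Boolean string). For a clause encoded as $\vec q_1s_1\vec q_2s_2\vec q_3s_3$, $\mathrm{Truth}_{bool}([\kappa],\vec p)=\bigvee_{j=1}^3\bigvee_{i=1}^n(\vec q_j=[i]\wedge(p_i\leftrightarrow s_j))$, where $\vec q=[k]$ abbreviates $\bigwedge_l(q_l\leftrightarrow[k]_l)$ and $x\leftrightarrow y$ abbreviates $(x\wedge y)\vee(\neg x\wedge\neg y)$. $\mathrm{Truth}_{bool}([\varphi],\vec p)=\bigwedge_{i=1}^m\mathrm{Truth}_{bool}([\kappa_i],\vec p)$. $\mathsf{AC}^0$-Frege: Frege proofs whose formulas have bounded depth over unbounded fan-in $\wedge,\vee$ and $\neg$. -}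

module Defs where

open import Data.Nat using (ℕ; zero; suc; _+_; _*_; _^_; _≤_; _⊔_; _%_; _/_; _≡ᵇ_)
open import Data.Nat.Logarithm using (⌈log₂_⌉)
open import Data.Bool using (Bool; true; false)
open import Data.Fin using (Fin; toℕ)
open import Data.List using (List; []; _∷_; [_]; map; zipWith; reverse; length; allFin)
open import Data.List.Membership.Propositional using (_∈_)
open import Data.List.Relation.Unary.All using (All)
open import Data.Product using (_×_; _,_)
open import Data.Vec using (Vec; toList)

-- Formulas over unbounded fan-in ∧, ∨ and ¬ ; variable p_(i+1) is `var i`

data Form : Set where
  var : ℕ → Form
  neg : Form → Form
  and : List Form → Form
  or  : List Form → Form

mutual
  size : Form → ℕ
  size (var _) = 1
  size (neg A) = suc (size A)
  size (and As) = suc (sizeL As)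
  size (or As)  = suc (sizeL As)

  sizeL : List Form → ℕ
  sizeL [] = 0
  sizeL (A ∷ As) = size A + sizeL As

mutual
  depth : Form → ℕ
  depth (var _) = 0
  depth (neg A) = suc (depth A)
  depth (and As) = suc (depthL As)
  depth (or As)  = suc (depthL As)

  depthL : List Form → ℕ
  depthL [] = 0
  depthL (A ∷ As) = depth A ⊔ depthL As

cst : Bool → Form
cst true  = and []
cst false = or []

_⇔_ : Form → Form → Form
x ⇔ y = or (and (x ∷ y ∷ []) ∷ and (neg x ∷ neg y ∷ []) ∷ [])

_⇒_ : Form → Form → Form
A ⇒ B = or (neg A ∷ B ∷ [])

-- Proof system: dag-like (line-based) sequent calculus PK for
-- unbounded fan-in formulas (bounded depth PK = AC0-Frege)

Sequent : Set
Sequent = List Form × List Form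

_⊆_ : List Form → List Form → Set
Γ ⊆ Δ = All (λ A → A ∈ Δ) Γ

data Step (prev : List Sequent) : Sequent → Set where
  ax   : ∀ {Γ Δ A} → A ∈ Γ → A ∈ Δ → Step prev (Γ , Δ)
  wk   : ∀ {Γ Δ Γ′ Δ′} → (Γ′ , Δ′) ∈ prev → Γ′ ⊆ Γ → Δ′ ⊆ Δ → Step prev (Γ , Δ)
  negL : ∀ {Γ Δ A} → (Γ , A ∷ Δ) ∈ prev → Step prev (neg A ∷ Γ , Δ)
  negR : ∀ {Γ Δ A} → (A ∷ Γ , Δ) ∈ prev → Step prev (Γ , neg A ∷ Δ)
  andL : ∀ {Γ Δ A As} → A ∈ As → (A ∷ Γ , Δ) ∈ prev → Step prev (and As ∷ Γ , Δ)
  andR : ∀ {Γ Δ As} → All (λ A → (Γ , A ∷ Δ) ∈ prev) As → Step prev (Γ , and As ∷ Δ)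
  orL  : ∀ {Γ Δ As} → All (λ A → (A ∷ Γ , Δ) ∈ prev) As → Step prev (or As ∷ Γ , Δ)
  orR  : ∀ {Γ Δ A As} → A ∈ As → (Γ , A ∷ Δ) ∈ prev → Step prev (Γ , or As ∷ Δ)
  cut  : ∀ {Γ Δ A} → (Γ , A ∷ Δ) ∈ prev → (A ∷ Γ , Δ) ∈ prev → Step prev (Γ , Δ)

-- A proof is a list of lines, newest first; each line follows from later-listed (earlier) lines
data Valid : List Sequent → Set where
  []  : Valid []
  _∷_ : ∀ {S π} → Step π S → Valid π → Valid (S ∷ π)

seqSize : Sequent → ℕ
seqSize (Γ , Δ) = sizeL Γ + sizeL Δ

seqDepth : Sequent → ℕ
seqDepth (Γ , Δ) = depthL Γ ⊔ depthL Δ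

proofSize : List Sequent → ℕ
proofSize [] = 0
proofSize (S ∷ π) = seqSize S + proofSize π

proofDepth : List Sequent → ℕ
proofDepth [] = 0
proofDepth (S ∷ π) = seqDepth S ⊔ proofDepth π

Proves : List Sequent → Form → Set
Proves π A = Valid π × (([] , [ A ]) ∈ π)

Literal : ℕ → Set
Literal n = Fin n × Bool          -- variable index (0-based), sign (true = positive)

Clause : ℕ → Set
Clause n = Vec (Literal n) 3

CNF3 : ℕ → Set
CNF3 n = List (Clause n)

litForm : ∀ {n} → Literal n → Form
litForm (i , true)  = var (toℕ i)
litForm (i , false) = neg (var (toℕ i))

clauseForm : ∀ {n} → Clause n → Form
clauseForm κ = or (map litForm (toList κ))

cnfForm : ∀ {n} → CNF3 n → Form
cnfForm φ = and (map clauseForm φ)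

bitsLE : ℕ → ℕ → List Bool
bitsLE zero    v = []
bitsLE (suc L) v = ((v % 2) ≡ᵇ 1) ∷ bitsLE L (v / 2)

enc : ℕ → ℕ → List Bool
enc n v = reverse (bitsLE ⌈log₂ n ⌉ v)

-- [i] for variable x_(i+1) (Fin index i) encodes the number i (= (i+1) - 1)
encVar : ∀ n → Fin n → List Bool
encVar n i = enc n (toℕ i)

encLit : ∀ n → Literal n → List Bool × Bool
encLit n (i , s) = encVar n i , s

-- encoding of a clause: q⃗₁ s₁ q⃗₂ s₂ q⃗₃ s₃ (as three segments)
encClause : ∀ n → Clause n → List (List Bool × Bool)
encClause n κ = map (encLit n) (toList κ)

eqBits : List Bool → List Bool → Form
eqBits qs ks = and (zipWith (λ q k → cst q ⇔ cst k) qs ks)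

truthClause : ∀ n → List (List Bool × Bool) → Form
truthClause n segs =
  or (map (λ { (q , s) → or (map (λ i → and (eqBits q (encVar n i) ∷ (var (toℕ i) ⇔ cst s) ∷ []))
                                 (allFin n)) }) segs)

truthCNF : ∀ n → CNF3 n → Form
truthCNF n φ = and (map (λ κ → truthClause n (encClause n κ)) φ)

-- A literal x_i^s of a clause κ implies the disjunct of Truth_bool([κ], p⃗) indexed by its own
-- position and its own variable i: there the equation q⃗ = [i] compares [i] with itself, so it
-- is provable bit by bit in O(1) lines per bit, and p_i ↔ s follows from the literal. Combining
-- these by ∨-left over the literals and ∧-right over the clauses proves φ(p⃗) → Truth_bool([φ], p⃗)
-- in O(m log n) lines for m clauses. Every line holds at most two subformulas of that implication, whose size is
-- O(m n log n) and whose depth is constant, so the proof has polynomial size and constant depth.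

module Submission where

open import Defs
open import Data.Nat using (ℕ; zero; suc; _+_; _*_; _^_; _≤_; z≤n; s≤s)
open import Data.Nat.Logarithm using (⌈log₂_⌉; ⌈log₂⌉-mono-≤; ⌈log₂2^n⌉≡n)
open import Data.Nat.Properties
open import Data.Bool using (Bool; true; false)
open import Data.Fin using (Fin; toℕ)
open import Data.List using (List; []; _∷_; map; zipWith; length; allFin; _++_)
open import Data.List.Properties
  using (length-++; length-map; length-reverse; length-tabulate; length-zipWith)
open import Data.List.Membership.Propositional using (_∈_)
open import Data.List.Membership.Propositional.Properties using (∈-map⁺; ∈-++⁺ˡ; ∈-++⁺ʳ; ∈-allFin)
open import Data.List.Relation.Binary.Subset.Propositional using () renaming (_⊆_ to _⊑_)
open import Data.List.Relation.Unary.All as All using (All; []; _∷_)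
open import Data.List.Relation.Unary.All.Properties using (++⁺; map⁺)
open import Data.List.Relation.Unary.Any using (here; there)
open import Data.Vec using ([]; _∷_)
open import Data.Product using (Σ; _×_; _,_; proj₁; proj₂)
open import Relation.Binary.PropositionalEquality using (_≡_; refl; sym; trans; cong; subst)

private
  variable
    A B : Form
    n : ℕ
    As Γ Δ Γ′ Δ′ : List Form
    S S₁ : Sequent
    π π′ : List Sequent
    k k′ : ℕ

Step-mono : π ⊑ π′ → Step π S → Step π′ S
Step-mono π⊑π′ (ax A∈Γ A∈Δ)     = ax A∈Γ A∈Δ
Step-mono π⊑π′ (wk p Γ′⊆Γ Δ′⊆Δ) = wk (π⊑π′ p) Γ′⊆Γ Δ′⊆Δ
Step-mono π⊑π′ (negL p)         = negL (π⊑π′ p)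
Step-mono π⊑π′ (negR p)         = negR (π⊑π′ p)
Step-mono π⊑π′ (andL A∈As p)    = andL A∈As (π⊑π′ p)
Step-mono π⊑π′ (andR ps)        = andR (All.map π⊑π′ ps)
Step-mono π⊑π′ (orL ps)         = orL (All.map π⊑π′ ps)
Step-mono π⊑π′ (orR A∈As p)     = orR A∈As (π⊑π′ p)
Step-mono π⊑π′ (cut p q)        = cut (π⊑π′ p) (π⊑π′ q)

Valid-++ : Valid π → Valid π′ → Valid (π ++ π′)
Valid-++ []       v′ = v′
Valid-++ (s ∷ v)  v′ = Step-mono ∈-++⁺ˡ s ∷ Valid-++ v v′

module Derivations (Good : Sequent → Set) where

  record Derivation (S : Sequent) (k : ℕ) : Set where
    field
      lines     : List Sequent
      valid     : Valid lines
      good      : All Good lines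
      length≤   : length lines ≤ k
      concludes : S ∈ lines
  open Derivation public

  infer₀ : Good S → Step [] S → Derivation S 1
  infer₀ g s = record
    { lines = _ ∷ [] ; valid = s ∷ [] ; good = g ∷ [] ; length≤ = ≤-refl ; concludes = here refl }

  infer₁ : Good S → (∀ {π} → S₁ ∈ π → Step π S) → Derivation S₁ k → Derivation S (suc k)
  infer₁ g rule d = record
    { lines = _ ∷ lines d ; valid = rule (concludes d) ∷ valid d ; good = g ∷ good d
    ; length≤ = s≤s (length≤ d) ; concludes = here refl }

  private
    join : (P : Form → Sequent) → All (λ A → Derivation (P A) k) As →
           Σ (List Sequent) λ π → Valid π × All Good π × length π ≤ length As * k × All (λ A → P A ∈ π) As
    join P [] = [] , [] , [] , z≤n , []
    join P (d ∷ ds) with join P ds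
    ... | π , v , gs , π≤ , P∈π =
      lines d ++ π , Valid-++ (valid d) v , ++⁺ (good d) gs ,
      ≤-trans (≤-reflexive (length-++ (lines d))) (+-mono-≤ (length≤ d) π≤) ,
      ∈-++⁺ˡ (concludes d) ∷ All.map (∈-++⁺ʳ (lines d)) P∈π

  inferAll : (P : Form → Sequent) → Good S → (∀ {π} → All (λ A → P A ∈ π) As → Step π S) →
             All (λ A → Derivation (P A) k) As → Derivation S (suc (length As * k))
  inferAll P g rule ds with join P ds
  ... | π , v , gs , π≤ , P∈π = record
    { lines = _ ∷ π ; valid = rule P∈π ∷ v ; good = g ∷ gs ; length≤ = s≤s π≤ ; concludes = here refl }

record Within (s d : ℕ) (A : Form) : Set where
  constructor within
  field
    size≤  : size A ≤ s
    depth≤ : depth A ≤ d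

∈⇒Within : A ∈ As → Within (sizeL As) (depthL As) A
∈⇒Within (here refl) = within (m≤m+n _ _) (m≤m⊔n _ _)
∈⇒Within {As = B ∷ _} (there A∈As) with ∈⇒Within A∈As
... | within s d = within (≤-trans s (m≤n+m _ (size B))) (≤-trans d (m≤n⊔m (depth B) _))

Within-components : ∀ {s d} → All (Within s d) As → sizeL As ≤ length As * s × depthL As ≤ d
Within-components []             = z≤n , z≤n
Within-components (within s d ∷ ws) with Within-components ws
... | s′ , d′ = +-mono-≤ s s′ , ⊔-lub d d′

Within-weaken : ∀ {s s′ d d′} → s ≤ s′ → d ≤ d′ → Within s d A → Within s′ d′ A
Within-weaken s≤s′ d≤d′ (within s d) = within (≤-trans s s≤s′) (≤-trans d d≤d′)

Within-∧ : ∀ {l s d} → length As ≤ l → All (Within s d) As → Within (suc (l * s)) (suc d) (and As)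
Within-∧ {s = s} l≤ ws = let (s′ , d′) = Within-components ws in
  within (s≤s (≤-trans s′ (*-monoˡ-≤ s l≤))) (s≤s d′)

Within-∨ : ∀ {l s d} → length As ≤ l → All (Within s d) As → Within (suc (l * s)) (suc d) (or As)
Within-∨ l≤ ws = let within s d = Within-∧ l≤ ws in within s d

Within-⇒ : ∀ {s t d} → Within s d A → Within t d B → Within (2 + s + t) (2 + d) (A ⇒ B)
Within-⇒ {B = B} {d = d} (within sA dA) (within sB dB) = within
  (s≤s (s≤s (+-mono-≤ sA (≤-trans (≤-reflexive (+-identityʳ (size B))) sB))))
  (s≤s (⊔-lub (s≤s dA) (⊔-lub (≤-trans dB (n≤1+n d)) z≤n)))

module Bounded (SF DF : ℕ) where

  Small : Form → Set
  Small = Within SF DF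

  private
    Small-components : suc (sizeL As) ≤ SF → suc (depthL As) ≤ DF → All Small As
    Small-components s d = All.tabulate λ A∈As → let within s′ d′ = ∈⇒Within A∈As in
      within (≤-trans s′ (<⇒≤ s)) (≤-trans d′ (<⇒≤ d))

  Small-∧ : Small (and As) → All Small As
  Small-∧ (within s d) = Small-components s d

  Small-∨ : Small (or As) → All Small As
  Small-∨ (within s d) = Small-components s d

  Small-neg : Small (neg A) → Small A
  Small-neg (within s d) = within (<⇒≤ s) (<⇒≤ d)

  Fits : Sequent → Set
  Fits (Γ , Δ) = All Small Γ × All Small Δ × length Γ + length Δ ≤ 2

  open Derivations Fits public

  -- Rules are applied backwards: a premise of a logical rule is no larger than its conclusion,
  -- so the invariant Fits only has to be established at the root.
  Derivable : Sequent → ℕ → Set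
  Derivable S k = Fits S → Derivation S k

  relax : k ≤ k′ → Derivable S k → Derivable S k′
  relax k≤k′ d fits = let D = d fits in record
    { lines = lines D ; valid = valid D ; good = good D
    ; length≤ = ≤-trans (length≤ D) k≤k′ ; concludes = concludes D }

  axiom : A ∈ Γ → A ∈ Δ → Derivable (Γ , Δ) (suc k)
  axiom A∈Γ A∈Δ = relax (s≤s z≤n) λ fits → infer₀ fits (ax A∈Γ A∈Δ)

  ¬R : Derivable (A ∷ Γ , Δ) k → Derivable (Γ , neg A ∷ Δ) (suc k)
  ¬R {Γ = Γ} {Δ = Δ} d fits@(sΓ , sA ∷ sΔ , c) =
    infer₁ fits negR (d (Small-neg sA ∷ sΓ , sΔ , subst (_≤ 2) (+-suc (length Γ) (length Δ)) c))

  ∧L : A ∈ As → Derivable (A ∷ Γ , Δ) k → Derivable (and As ∷ Γ , Δ) (suc k)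
  ∧L A∈As d fits@(sAs ∷ sΓ , sΔ , c) =
    infer₁ fits (andL A∈As) (d (All.lookup (Small-∧ sAs) A∈As ∷ sΓ , sΔ , c))

  ∨R : A ∈ As → Derivable (Γ , A ∷ Δ) k → Derivable (Γ , or As ∷ Δ) (suc k)
  ∨R A∈As d fits@(sΓ , sAs ∷ sΔ , c) =
    infer₁ fits (orR A∈As) (d (sΓ , All.lookup (Small-∨ sAs) A∈As ∷ sΔ , c))

  ∧R : All (λ A → Derivable (Γ , A ∷ Δ) k) As → Derivable (Γ , and As ∷ Δ) (suc (length As * k))
  ∧R {Γ = Γ} {Δ = Δ} ds fits@(sΓ , sAs ∷ sΔ , c) =
    inferAll (λ A → Γ , A ∷ Δ) fits andR
      (All.zipWith (λ (d , sA) → d (sΓ , sA ∷ sΔ , c)) (ds , Small-∧ sAs))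

  ∨L : All (λ A → Derivable (A ∷ Γ , Δ) k) As → Derivable (or As ∷ Γ , Δ) (suc (length As * k))
  ∨L {Γ = Γ} {Δ = Δ} ds fits@(sAs ∷ sΓ , sΔ , c) =
    inferAll (λ A → A ∷ Γ , Δ) fits orL
      (All.zipWith (λ (d , sA) → d (sA ∷ sΓ , sΔ , c)) (ds , Small-∨ sAs))

  weaken : Γ′ ⊆ Γ → Δ′ ⊆ Δ → Derivation (Γ′ , Δ′) k → Derivable (Γ , Δ) (suc k)
  weaken Γ′⊆Γ Δ′⊆Δ d fits = infer₁ fits (λ p → wk p Γ′⊆Γ Δ′⊆Δ) d

  -- ∨R only introduces the first succedent formula, so both disjuncts are introduced in
  -- turn, with an exchange in between and a contraction at the end.
  ∨R₂ : Derivable ([] , A ∷ B ∷ []) k → Derivable ([] , or (A ∷ B ∷ []) ∷ []) (4 + k)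
  ∨R₂ {A = A} {B = B} {k = k} d fits@([] , sA∨B ∷ [] , _) =
    weaken [] (here refl ∷ here refl ∷ []) ⊢A∨B,A∨B fits
    where
      sB : Small B
      sB = All.lookup (Small-∨ {As = A ∷ B ∷ []} sA∨B) (there (here refl))

      ⊢A∨B,B : Derivation ([] , or (A ∷ B ∷ []) ∷ B ∷ []) (suc k)
      ⊢A∨B,B = ∨R (here refl) d ([] , sA∨B ∷ sB ∷ [] , ≤-refl)
      ⊢B,A∨B : Derivation ([] , B ∷ or (A ∷ B ∷ []) ∷ []) (2 + k)
      ⊢B,A∨B = weaken [] (there (here refl) ∷ here refl ∷ []) ⊢A∨B,B ([] , sB ∷ sA∨B ∷ [] , ≤-refl)
      ⊢A∨B,A∨B : Derivation ([] , or (A ∷ B ∷ []) ∷ or (A ∷ B ∷ []) ∷ []) (3 + k)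
      ⊢A∨B,A∨B = ∨R (there (here refl)) (λ _ → ⊢B,A∨B) ([] , sA∨B ∷ sA∨B ∷ [] , ≤-refl)

  ⇒R : Derivable (A ∷ [] , B ∷ []) k → Derivable ([] , A ⇒ B ∷ []) (5 + k)
  ⇒R d = ∨R₂ (¬R d)

  Fits⇒seqSize≤ : Fits S → seqSize S ≤ 2 * SF
  Fits⇒seqSize≤ {Γ , Δ} (sΓ , sΔ , c) = begin
    sizeL Γ + sizeL Δ
      ≤⟨ +-mono-≤ (proj₁ (Within-components sΓ)) (proj₁ (Within-components sΔ)) ⟩
    length Γ * SF + length Δ * SF      ≡⟨ *-distribʳ-+ SF (length Γ) (length Δ) ⟨
    (length Γ + length Δ) * SF         ≤⟨ *-monoˡ-≤ SF c ⟩
    2 * SF                             ∎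
    where open ≤-Reasoning

  proofSize≤ : All Fits π → proofSize π ≤ length π * (2 * SF)
  proofSize≤ []            = z≤n
  proofSize≤ (fits ∷ fitss) = +-mono-≤ (Fits⇒seqSize≤ fits) (proofSize≤ fitss)

  proofDepth≤ : All Fits π → proofDepth π ≤ DF
  proofDepth≤ []                    = z≤n
  proofDepth≤ ((sΓ , sΔ , _) ∷ fitss) =
    ⊔-lub (⊔-lub (proj₂ (Within-components sΓ)) (proj₂ (Within-components sΔ))) (proofDepth≤ fitss)

-- The pattern lambda of truthClause applied to one encoded literal (q⃗ , s).
literalTruth : ∀ n → List Bool → Bool → Form
literalTruth n q s = or (map (λ i → and (eqBits q (encVar n i) ∷ (var (toℕ i) ⇔ cst s) ∷ [])) (allFin n))

length-bitsLE : ∀ L v → length (bitsLE L v) ≡ L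
length-bitsLE zero    v = refl
length-bitsLE (suc L) v = cong suc (length-bitsLE L _)

length-encVar : ∀ n (i : Fin n) → length (encVar n i) ≡ ⌈log₂ n ⌉
length-encVar n i = trans (length-reverse (bitsLE ⌈log₂ n ⌉ (toℕ i))) (length-bitsLE _ _)

literalLines : ℕ → ℕ
literalLines L = 2 + 2 * (6 + L * 6)

clauseLines : ℕ → ℕ
clauseLines L = suc (3 * suc (literalLines L))

cnfLines : ℕ → ℕ → ℕ
cnfLines L m = suc (m * suc (clauseLines L))

module CNFDerivations (SF DF : ℕ) where
  open Bounded SF DF

  ⊢⊤ : Derivable (Γ , cst true ∷ Δ) (suc k)
  ⊢⊤ = relax (s≤s z≤n) (∧R {k = 0} [])

  ⊢¬⊥ : Derivable (Γ , neg (cst false) ∷ Δ) (2 + k)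
  ⊢¬⊥ = ¬R (relax (s≤s z≤n) (∨L {k = 0} []))

  ⊢b⇔b : ∀ b → Derivable (Γ , cst b ⇔ cst b ∷ Δ) 6
  ⊢b⇔b true  = ∨R (here refl)         (∧R {k = 2} (⊢⊤ ∷ ⊢⊤ ∷ []))
  ⊢b⇔b false = ∨R (there (here refl)) (∧R {k = 2} (⊢¬⊥ ∷ ⊢¬⊥ ∷ []))

  ⊢eqBits-refl : ∀ q → Derivable (Γ , eqBits q q ∷ Δ) (suc (length q * 6))
  ⊢eqBits-refl q =
    subst (Derivable _) (cong (λ l → suc (l * 6)) (trans (length-zipWith _ q q) (⊓-idem (length q))))
          (∧R (⊢bits q))
    where
      ⊢bits : ∀ q → All (λ A → Derivable (Γ , A ∷ Δ) 6) (zipWith (λ x y → cst x ⇔ cst y) q q)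
      ⊢bits []      = []
      ⊢bits (b ∷ q) = ⊢b⇔b b ∷ ⊢bits q

  literal⊢var⇔cst : (i : Fin n) (s : Bool) → Derivable (litForm (i , s) ∷ Γ , var (toℕ i) ⇔ cst s ∷ Δ) 6
  literal⊢var⇔cst i true  = ∨R (here refl)         (∧R {k = 2} (axiom (here refl) (here refl) ∷ ⊢⊤ ∷ []))
  literal⊢var⇔cst i false = ∨R (there (here refl)) (∧R {k = 2} (axiom (here refl) (here refl) ∷ ⊢¬⊥ ∷ []))

  -- The witness for the disjunction over variables is the literal's own variable i, for which
  -- the equation q⃗ = [i] has identical sides.
  literal⊢literalTruth : (i : Fin n) (s : Bool) →
    Derivable (litForm (i , s) ∷ Γ , literalTruth n (encVar n i) s ∷ Δ) (literalLines ⌈log₂ n ⌉)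
  literal⊢literalTruth {n} i s = ∨R (∈-map⁺ _ (∈-allFin i))
    (∧R (relax (s≤s (≤-trans (≤-reflexive (cong (_* 6) (length-encVar n i))) (m≤n+m _ 5)))
                (⊢eqBits-refl (encVar n i))
       ∷ relax (m≤m+n 6 _) (literal⊢var⇔cst i s) ∷ []))

  clause⊢clauseTruth : (κ : Clause n) →
    Derivable (clauseForm κ ∷ Γ , truthClause n (encClause n κ) ∷ Δ) (clauseLines ⌈log₂ n ⌉)
  clause⊢clauseTruth ((i₁ , s₁) ∷ (i₂ , s₂) ∷ (i₃ , s₃) ∷ []) = ∨L
    ( ∨R (here refl)                 (literal⊢literalTruth i₁ s₁)
    ∷ ∨R (there (here refl))         (literal⊢literalTruth i₂ s₂)
    ∷ ∨R (there (there (here refl))) (literal⊢literalTruth i₃ s₃)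
    ∷ [])

  cnf⊢truthCNF : (φ : CNF3 n) →
    Derivable (cnfForm φ ∷ Γ , truthCNF n φ ∷ Δ) (cnfLines ⌈log₂ n ⌉ (length φ))
  cnf⊢truthCNF {n} φ = subst (Derivable _) (cong (λ m → suc (m * _)) (length-map _ φ))
    (∧R (map⁺ (All.tabulate λ κ∈φ → ∧L (∈-map⁺ clauseForm κ∈φ) (clause⊢clauseTruth _))))

Within-cst⇔cst : ∀ b c → Within 9 4 (cst b ⇔ cst c)
Within-cst⇔cst true  true  = within ≤-refl ≤-refl
Within-cst⇔cst true  false = within ≤-refl ≤-refl
Within-cst⇔cst false true  = within ≤-refl ≤-refl
Within-cst⇔cst false false = within ≤-refl ≤-refl

Within-var⇔cst : ∀ j s → Within 9 4 (var j ⇔ cst s)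
Within-var⇔cst j true  = within ≤-refl ≤-refl
Within-var⇔cst j false = within ≤-refl ≤-refl

Within-eqBits : ∀ q r → Within (suc (length q * 9)) 5 (eqBits q r)
Within-eqBits q r = Within-∧ (≤-trans (≤-reflexive (length-zipWith _ q r)) (m⊓n≤m _ _)) (bits q r)
  where
    bits : ∀ q r → All (Within 9 4) (zipWith (λ x y → cst x ⇔ cst y) q r)
    bits []      _       = []
    bits (_ ∷ _) []      = []
    bits (b ∷ q) (c ∷ r) = Within-cst⇔cst b c ∷ bits q r

Within-literal : ∀ (l : Literal n) → Within 2 1 (litForm l)
Within-literal (i , true)  = within (s≤s z≤n) z≤n
Within-literal (i , false) = within ≤-refl ≤-refl

conjunctSize : ℕ → ℕ
conjunctSize L = suc (2 * (suc (L * 9) + 9))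

literalTruthSize : ℕ → ℕ → ℕ
literalTruthSize n L = suc (n * conjunctSize L)

clauseTruthSize : ℕ → ℕ → ℕ
clauseTruthSize n L = suc (3 * literalTruthSize n L)

truthCNFSize : ℕ → ℕ → ℕ → ℕ
truthCNFSize n L m = suc (m * clauseTruthSize n L)

formulaSize : ℕ → ℕ → ℕ → ℕ
formulaSize n L m = 2 + suc (m * 7) + truthCNFSize n L m

Within-literalTruth : ∀ n q s → Within (literalTruthSize n (length q)) 7 (literalTruth n q s)
Within-literalTruth n q s =
  Within-∨ (≤-reflexive (trans (length-map _ (allFin n)) (length-tabulate {n = n} (λ i → i))))
           (map⁺ (All.universal conjunct (allFin n)))
  where
    conjunct : ∀ i →
      Within (conjunctSize (length q)) 6 (and (eqBits q (encVar n i) ∷ (var (toℕ i) ⇔ cst s) ∷ []))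
    conjunct i = Within-∧ ≤-refl
      ( Within-weaken (m≤m+n _ 9) ≤-refl (Within-eqBits q (encVar n i))
      ∷ Within-weaken (m≤n+m 9 (suc (length q * 9))) (n≤1+n 4) (Within-var⇔cst (toℕ i) s) ∷ [])

Within-clauseTruth : ∀ (κ : Clause n) →
  Within (clauseTruthSize n ⌈log₂ n ⌉) 8 (truthClause n (encClause n κ))
Within-clauseTruth {n} ((i₁ , s₁) ∷ (i₂ , s₂) ∷ (i₃ , s₃) ∷ []) =
  Within-∨ ≤-refl (literal i₁ s₁ ∷ literal i₂ s₂ ∷ literal i₃ s₃ ∷ [])
  where
    literal : ∀ i s → Within (literalTruthSize n ⌈log₂ n ⌉) 7 (literalTruth n (encVar n i) s)
    literal i s = subst (λ L → Within (literalTruthSize n L) 7 (literalTruth n (encVar n i) s))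
                        (length-encVar n i) (Within-literalTruth n (encVar n i) s)

Within-clause : ∀ (κ : Clause n) → Within 7 2 (clauseForm κ)
Within-clause (l₁ ∷ l₂ ∷ l₃ ∷ []) =
  Within-∨ ≤-refl (Within-literal l₁ ∷ Within-literal l₂ ∷ Within-literal l₃ ∷ [])

Within-formula : ∀ n (φ : CNF3 n) →
  Within (formulaSize n ⌈log₂ n ⌉ (length φ)) 11 (cnfForm φ ⇒ truthCNF n φ)
Within-formula n φ = Within-⇒ (Within-weaken ≤-refl (≤-trans (n≤1+n 3) (m≤m+n 4 5)) cnf) truth
  where
    cnf : Within (suc (length φ * 7)) 3 (cnfForm φ)
    cnf = Within-∧ (≤-reflexive (length-map _ φ)) (map⁺ (All.universal Within-clause φ))

    truth : Within (truthCNFSize n ⌈log₂ n ⌉ (length φ)) 9 (truthCNF n φ)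
    truth = Within-∧ (≤-reflexive (length-map _ φ)) (map⁺ (All.universal Within-clauseTruth φ))

proofSizeBound : ℕ → ℕ → ℕ → ℕ
proofSizeBound n L m = (5 + cnfLines L m) * (2 * formulaSize n L m)

module PolynomialBound (u : ℕ) (1≤u : 1 ≤ u) where

  infix 4 _≲_·u^_
  record _≲_·u^_ (x a d : ℕ) : Set where
    constructor poly≤
    field ≲⇒≤ : x ≤ a * u ^ d
  open _≲_·u^_ public

  private
    variable
      a b d e x y : ℕ

    1≤u^ : ∀ d → 1 ≤ u ^ d
    1≤u^ zero    = ≤-refl
    1≤u^ (suc d) = *-mono-≤ 1≤u (1≤u^ d)

    u^-mono : d ≤ e → u ^ d ≤ u ^ e
    u^-mono {e = e} z≤n = 1≤u^ e
    u^-mono (s≤s d≤e)   = *-monoʳ-≤ u (u^-mono d≤e)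

  ≲-const : ∀ c d → c ≲ c ·u^ d
  ≲-const c d = poly≤ (≤-trans (≤-reflexive (sym (*-identityʳ c))) (*-monoʳ-≤ c (1≤u^ d)))

  ≲-u : x ≤ u → x ≲ 1 ·u^ 1
  ≲-u x≤u = poly≤ (≤-trans x≤u (≤-reflexive (sym (trans (*-identityˡ (u * 1)) (*-identityʳ u)))))

  ≲-suc : x ≲ a ·u^ d → suc x ≲ suc a ·u^ d
  ≲-suc {d = d} (poly≤ x≤) = poly≤ (+-mono-≤ (1≤u^ d) x≤)

  ≲-+ : x ≲ a ·u^ d → y ≲ b ·u^ d → x + y ≲ a + b ·u^ d
  ≲-+ {a = a} {d = d} {b = b} (poly≤ x≤) (poly≤ y≤) =
    poly≤ (≤-trans (+-mono-≤ x≤ y≤) (≤-reflexive (sym (*-distribʳ-+ (u ^ d) a b))))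

  ≲-* : x ≲ a ·u^ d → y ≲ b ·u^ e → x * y ≲ a * b ·u^ (d + e)
  ≲-* {a = a} {d = d} {b = b} {e = e} (poly≤ x≤) (poly≤ y≤) = poly≤ (begin
    _                           ≤⟨ *-mono-≤ x≤ y≤ ⟩
    a * u ^ d * (b * u ^ e)     ≡⟨ [m*n]*[o*p]≡[m*o]*[n*p] a (u ^ d) b (u ^ e) ⟩
    a * b * (u ^ d * u ^ e)     ≡⟨ cong (a * b *_) (^-distribˡ-+-* u d e) ⟨
    a * b * u ^ (d + e)         ∎)
    where open ≤-Reasoning

  ≲-degree : d ≤ e → x ≲ a ·u^ d → x ≲ a ·u^ e
  ≲-degree {a = a} d≤e (poly≤ x≤) = poly≤ (≤-trans x≤ (*-monoʳ-≤ a (u^-mono d≤e)))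

  ≲-proofSizeBound : ∀ {n L m} → n ≤ u → L ≤ u → m ≤ u → proofSizeBound n L m ≲ 23496 ·u^ 5
  ≲-proofSizeBound {n} {L} {m} n≤u L≤u m≤u = ≲-* lines≲ (≲-* (≲-const 2 0) formulaSize≲)
    where
      n≲ : n ≲ 1 ·u^ 1
      n≲ = ≲-u n≤u

      L≲ : L ≲ 1 ·u^ 1
      L≲ = ≲-u L≤u

      m≲ : m ≲ 1 ·u^ 1
      m≲ = ≲-u m≤u

      literalLines≲ : literalLines L ≲ 26 ·u^ 1
      literalLines≲ = ≲-+ (≲-const 2 1) (≲-* (≲-const 2 0) (≲-+ (≲-const 6 1) (≲-* L≲ (≲-const 6 0))))

      lines≲ : 5 + cnfLines L m ≲ 89 ·u^ 2
      lines≲ = ≲-+ (≲-const 5 2) (≲-suc (≲-* m≲ (≲-suc (≲-suc (≲-* (≲-const 3 0) (≲-suc literalLines≲))))))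

      conjunctSize≲ : conjunctSize L ≲ 39 ·u^ 1
      conjunctSize≲ = ≲-suc (≲-* (≲-const 2 0) (≲-+ (≲-suc (≲-* L≲ (≲-const 9 0))) (≲-const 9 1)))

      formulaSize≲ : formulaSize n L m ≲ 132 ·u^ 3
      formulaSize≲ = ≲-+ (≲-degree (s≤s z≤n) (≲-+ (≲-const 2 1) (≲-suc (≲-* m≲ (≲-const 7 0)))))
                         (≲-suc (≲-* m≲ (≲-suc (≲-* (≲-const 3 0) (≲-suc (≲-* n≲ conjunctSize≲))))))

^-distribʳ-* : ∀ m n o → (m * n) ^ o ≡ m ^ o * n ^ o
^-distribʳ-* m n zero    = refl
^-distribʳ-* m n (suc o) =
  trans (cong (m * n *_) (^-distribʳ-* m n o)) ([m*n]*[o*p]≡[m*o]*[n*p] m n (m ^ o) (n ^ o))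

n≤2^n : ∀ n → n ≤ 2 ^ n
n≤2^n zero    = z≤n
n≤2^n (suc n) = +-mono-≤ (m^n>0 2 n) (≤-trans (n≤2^n n) (m≤m+n (2 ^ n) 0))

⌈log₂n⌉≤n : ∀ n → ⌈log₂ n ⌉ ≤ n
⌈log₂n⌉≤n n = ≤-trans (⌈log₂⌉-mono-≤ (n≤2^n n)) (≤-reflexive (⌈log₂2^n⌉≡n n))

-- For n ≥ 1 this is (n + 1)^e ≤ 2^e n^e; the summand c covers n = 0.
*-suc^≤poly : ∀ a e n → let c = a * 2 ^ e + e in a * suc n ^ e ≤ c * n ^ c + c
*-suc^≤poly a e zero = begin
  a * 1 ^ e                  ≡⟨ trans (cong (a *_) (^-zeroˡ e)) (*-identityʳ a) ⟩
  a                          ≤⟨ m≤m*n a (2 ^ e) {{m^n≢0 2 e}} ⟩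
  a * 2 ^ e                  ≤⟨ m≤m+n (a * 2 ^ e) e ⟩
  c                          ≤⟨ m≤n+m c (c * 0 ^ c) ⟩
  c * 0 ^ c + c              ∎
  where
    open ≤-Reasoning
    c : ℕ
    c = a * 2 ^ e + e
*-suc^≤poly a e n@(suc _) = begin
  a * suc n ^ e              ≤⟨ *-monoʳ-≤ a (^-monoˡ-≤ e suc-n≤2*n) ⟩
  a * (2 * n) ^ e            ≡⟨ cong (a *_) (^-distribʳ-* 2 n e) ⟩
  a * (2 ^ e * n ^ e)        ≡⟨ *-assoc a (2 ^ e) (n ^ e) ⟨
  a * 2 ^ e * n ^ e          ≤⟨ *-mono-≤ (m≤m+n (a * 2 ^ e) e) (^-monoʳ-≤ n (m≤n+m e (a * 2 ^ e))) ⟩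
  c * n ^ c                  ≤⟨ m≤m+n _ c ⟩
  c * n ^ c + c              ∎
  where
    open ≤-Reasoning
    c : ℕ
    c = a * 2 ^ e + e

    suc-n≤2*n : suc n ≤ 2 * n
    suc-n≤2*n = ≤-trans (m<m*n n 2 (s≤s (s≤s z≤n))) (≤-reflexive (*-comm n 2))

sizeConstant : ℕ → ℕ
sizeConstant k = 23496 * suc k ^ 5 * 2 ^ (suc k * 5) + suc k * 5

proofSizeBound≤poly : ∀ k n m → m ≤ n ^ k + k → let c = sizeConstant k in
  proofSizeBound n ⌈log₂ n ⌉ m ≤ c * n ^ c + c
proofSizeBound≤poly k n m m≤ = begin
  proofSizeBound n ⌈log₂ n ⌉ m
    ≤⟨ ≲⇒≤ (≲-proofSizeBound n≤u (≤-trans (⌈log₂n⌉≤n n) n≤u) m≤u) ⟩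
  23496 * u ^ 5                                ≡⟨ cong (23496 *_) u^5≡ ⟩
  23496 * (suc k ^ 5 * suc n ^ (suc k * 5))    ≡⟨ *-assoc 23496 (suc k ^ 5) _ ⟨
  23496 * suc k ^ 5 * suc n ^ (suc k * 5)      ≤⟨ *-suc^≤poly (23496 * suc k ^ 5) (suc k * 5) n ⟩
  _                                            ∎
  where
    open ≤-Reasoning
    v u : ℕ
    v = suc n ^ suc k
    u = suc k * v

    1≤v : 1 ≤ v
    1≤v = m^n>0 (suc n) (suc k)

    v≤u : v ≤ u
    v≤u = m≤m+n v (k * v)

    n≤u : n ≤ u
    n≤u = ≤-trans (≤-trans (n≤1+n n) (≤-reflexive (sym (*-identityʳ (suc n)))))
                  (≤-trans (^-monoʳ-≤ (suc n) (s≤s (z≤n {k}))) v≤u)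

    m≤u : m ≤ u
    m≤u = ≤-trans m≤ (+-mono-≤ (≤-trans (^-monoˡ-≤ k (n≤1+n n)) (^-monoʳ-≤ (suc n) (n≤1+n k)))
                               (m≤m*n k v {{m^n≢0 (suc n) (suc k)}}))

    u^5≡ : u ^ 5 ≡ suc k ^ 5 * suc n ^ (suc k * 5)
    u^5≡ = trans (^-distribʳ-* (suc k) v 5) (cong (suc k ^ 5 *_) (^-*-assoc (suc n) (suc k) 5))

    open PolynomialBound u (≤-trans 1≤v v≤u)

cnf⇒truth-proof : ∀ n (φ : CNF3 n) → Σ (List Sequent) λ π → Proves π (cnfForm φ ⇒ truthCNF n φ) ×
  proofDepth π ≤ 11 × proofSize π ≤ proofSizeBound n ⌈log₂ n ⌉ (length φ)
cnf⇒truth-proof n φ =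
  lines D , (valid D , concludes D) , ≤-trans (proofDepth≤ (good D)) depth≤ , size-bound
  where
    F : Form
    F = cnfForm φ ⇒ truthCNF n φ

    F-within : Within (formulaSize n ⌈log₂ n ⌉ (length φ)) 11 F
    F-within = Within-formula n φ

    open Within F-within
    open Bounded (size F) (depth F)
    open CNFDerivations (size F) (depth F)

    D : Derivation ([] , F ∷ []) (5 + cnfLines ⌈log₂ n ⌉ (length φ))
    D = ⇒R (cnf⊢truthCNF φ) ([] , within ≤-refl ≤-refl ∷ [] , s≤s z≤n)

    size-bound : proofSize (lines D) ≤ proofSizeBound n ⌈log₂ n ⌉ (length φ)
    size-bound = ≤-trans (proofSize≤ (good D)) (*-mono-≤ (length≤ D) (*-monoʳ-≤ 2 size≤))

lemma4p9 : Σ ℕ λ d → (k : ℕ) → Σ ℕ λ c → (n : ℕ) (φ : CNF3 n) →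
    length φ ≤ n ^ k + k →
    Σ (List Sequent) λ π → Proves π (cnfForm φ ⇒ truthCNF n φ) ×
    proofDepth π ≤ d × proofSize π ≤ c * n ^ c + c
lemma4p9 = 11 , λ k → sizeConstant k , λ n φ m≤ →
  let π , proves , depth≤ , size≤ = cnf⇒truth-proof n φ in
  π , proves , depth≤ , ≤-trans size≤ (proofSizeBound≤poly k n (length φ) m≤)
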